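{- Let $2\le\sigma\le n$. Any algorithm solving $\mathrm{select}$ queries on a string $s\in[\sigma]^n$ using at most $t=o(\log\sigma)$ character probes (i.e. calls to $\mathrm{access}$) per query requires a succinct index with $r=\Omega\big(\frac{n\log\sigma}{t}\big)$ bits of redundancy.
   Context: $[\sigma]=\{0,\dots,\sigma-1\}$; logarithms are base 2. The string $s$ is read-only and can be read only through $\mathrm{access}(i)$, returning $s[i]$; each call is a probe. $\mathrm{select}(c,j)$ returns the position in $s$ of the $j$th occurrence of symbol $c$, or $-1$ if it does not exist. A succinct index is auxiliary information of $r$ bits (the redundancy, not counting the space to store $s$) computed from $s$ in a preprocessing step; the query algorithm may read the index but accesses $s$ only by probes, and $t$ is the maximum number of probes used to answer a query. The redundancy $r$ is the worst case over strings $s\in[\sigma]^n$. -}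

module Defs where

open import Data.Nat using (ℕ; zero; suc; _+_; _*_; _≤_)
open import Data.Nat.Logarithm using (⌊log₂_⌋)
open import Data.Fin using (Fin)
open import Data.Fin.Properties using () renaming (_≟_ to _≟F_)
open import Data.Vec using (Vec; lookup)
open import Data.Bool using (Bool)
open import Data.Maybe using (Maybe; just; nothing)
open import Data.List using (List; []; _∷_; filter; allFin)
open import Data.Product using (∃-syntax; _×_)
open import Relation.Binary.PropositionalEquality using (_≡_)

Str : ℕ → ℕ → Set
Str σ n = Vec (Fin σ) n

-- Adaptive probe algorithm (decision tree) making at most t probes
-- access(i) = s[i] on a string of length n over [σ], returning an A.
data Probes (σ n : ℕ) (A : Set) : ℕ → Set where
  done  : ∀ {t} → A → Probes σ n A t
  probe : ∀ {t} → Fin n → (Fin σ → Probes σ n A t) → Probes σ n A (suc t)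

run : ∀ {σ n t} {A : Set} → Str σ n → Probes σ n A t → A
run s (done a)    = a
run s (probe i k) = run s (k (lookup s i))

-- j-th element of a list, counting from 1; nothing if absent (or j = 0).
nth : ∀ {A : Set} → List A → ℕ → Maybe A
nth []       _             = nothing
nth (x ∷ xs) zero          = nothing
nth (x ∷ xs) (suc zero)    = just x
nth (x ∷ xs) (suc (suc j)) = nth xs (suc j)

-- select(c, j): position of the j-th occurrence of c in s (1-based j),
-- or nothing (the paper's -1) if it does not exist.
select : ∀ {σ n} → Str σ n → Fin σ → ℕ → Maybe (Fin n)
select s c j = nth (filter (λ i → lookup s i ≟F c) (allFin _)) j

-- A succinct index of r bits for select on [σ]^n with at most t probes:
-- preprocessing s ↦ r-bit index; the query algorithm reads the whole index
-- and the query (c, j), and accesses s only through at most t probes.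
record SelectIndex (σ n t r : ℕ) : Set where
  field
    index   : Str σ n → Vec Bool r
    query   : Vec Bool r → Fin σ → ℕ → Probes σ n (Maybe (Fin n)) t
    correct : ∀ (s : Str σ n) (c : Fin σ) (j : ℕ) →
              run s (query (index s) c j) ≡ select s c j

-- t = o(log σ)  (as σ → ∞, uniformly over n ≥ σ):
-- for every k there is M with k·t(σ,n) ≤ ⌊log σ⌋ whenever M ≤ σ ≤ n.
LittleOLogσ : (ℕ → ℕ → ℕ) → Set
LittleOLogσ t = ∀ (k : ℕ) → ∃[ M ] ∀ (σ n : ℕ) → M ≤ σ → σ ≤ n →
  k * t σ n ≤ ⌊log₂ σ ⌋

-- r = Ω(n log σ / t): there are c, N with n·⌊log σ⌋ ≤ c·(1+t)·r whenever N ≤ σ ≤ n.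
-- (1 + t is used instead of t to avoid division by zero; equal up to constants for t ≥ 1.)
BigOmegaBound : (ℕ → ℕ → ℕ) → (ℕ → ℕ → ℕ) → Set
BigOmegaBound t r = ∃[ c ] ∃[ N ] ∀ (σ n : ℕ) → N ≤ σ → σ ≤ n →
  n * ⌊log₂ σ ⌋ ≤ c * (suc (t σ n) * r σ n)

module Submission where

-- An encoding argument.  Given a select index with r bits and t probes, we
-- describe every s ∈ [σ]^n by its index plus two advice streams and rebuild s
-- from them.  The decoder keeps partial knowledge of s; for each character c
-- and rank j = 1, 2, ... it asks a ternary question (is there a j-th c, and is
-- its position known?).  If the position is unknown it runs the query (c, j),
-- answering probes from its knowledge, else by a ternary flag "s[i] = c?" and,
-- only if the flag says no, by reading s[i] from the value stream; the answer
-- p is recorded as an occurrence of c.  A query reading y ≤ t values learns at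
-- least y + 1 unknown entries, so at most t·n/(t+1) values and at most σ + 2n
-- ternary answers are used: σ^n ≤ 2^r · 3^(σ+2n) · σ^(t·n/(t+1)), whence
-- n·log σ/(t+1) ≤ r + 5n, which gives the bound once t = o(log σ).

open import Defs
open import Data.Bool using (Bool; true; false; if_then_else_)
open import Data.Empty using (⊥-elim)
open import Data.Fin using (Fin; zero; suc)
open import Data.Fin.Patterns using (0F; 1F; 2F)
open import Data.Fin.Properties using (injective⇒≤; 2↔Bool; *↔×) renaming (_≟_ to _≟F_)
open import Data.List using (List; []; _∷_; _++_; length; filter; allFin)
open import Data.List.Membership.Propositional using (_∈_)
open import Data.List.Membership.Propositional.Properties using (∈-filter⁺; ∈-filter⁻; ∈-allFin)
open import Data.List.Properties using (length-filter; length-tabulate)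
open import Data.List.Relation.Unary.Any using (here; there)
open import Data.Maybe using (Maybe; just; nothing)
open import Data.Maybe.Properties using (just-injective)
open import Data.Nat
open import Data.Nat.DivMod using (_/_; m*n/n≡m; /-monoˡ-≤; m/n*n≤m)
open import Data.Nat.Induction using (<-wellFounded)
open import Data.Nat.Logarithm using (⌊log₂_⌋; ⌊log₂⌋-mono-≤; ⌊log₂[2^n]⌋≡n)
open import Data.Nat.Logarithm.Core using (⌊log2⌋)
open import Data.Nat.Properties
open import Algebra.Properties.CommutativeMonoid.Sum +-0-commutativeMonoid
  using (sum-syntax; ∑-distrib-+; sum-cong-≗; sum-replicate-zero)
open import Data.Nat.Solver using (module +-*-Solver)
open import Data.Product using (Σ; _×_; _,_; proj₁; proj₂; ∃-syntax)
open import Data.Sum using (inj₁; inj₂)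
open import Data.Product.Function.NonDependent.Propositional using (_×-↔_)
open import Data.Vec as Vec using (Vec; []; _∷_; lookup; replicate; _[_]≔_)
open import Data.Vec.Properties using (lookup∘update; lookup∘update′; lookup-replicate)
open import Data.Vec.Recursive using (fromVec; toVec; lift↔; Fin[m^n]↔Fin[m]^n)
open import Data.Vec.Recursive.Properties using (fromVec∘toVec; toVec∘fromVec)
open import Data.Vec.Relation.Binary.Pointwise.Extensional using (ext; Pointwise-≡⇒≡)
open import Function using (_↔_; mk↔ₛ′; Inverse; Injection; Injective; _∘_; id)
open import Function.Properties.Inverse using (↔-refl; ↔-sym; ↔-trans; ↔⇒↣)
open import Induction.WellFounded using (Acc; acc)
open import Relation.Binary.PropositionalEquality
open import Relation.Nullary using (yes; no; does)

open +-*-Solver using (solve; _:=_; _:+_; _:*_; con)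

vec↔ : ∀ {X : Set} {a} k → X ↔ Fin a → Vec X k ↔ Fin (a ^ k)
vec↔ {a = a} k X↔a =
  ↔-trans (mk↔ₛ′ fromVec (toVec k) (fromVec∘toVec k) toVec∘fromVec)
          (↔-trans (lift↔ k X↔a) (↔-sym (Fin[m^n]↔Fin[m]^n a k)))

×↔ : ∀ {X Y : Set} {a b} → X ↔ Fin a → Y ↔ Fin b → (X × Y) ↔ Fin (a * b)
×↔ {a = a} X↔a Y↔b = ↔-trans (X↔a ×-↔ Y↔b) (↔-sym (*↔× {a}))

injection⇒≤ : ∀ {X Y : Set} {a b} → X ↔ Fin a → Y ↔ Fin b →
              (f : X → Y) → Injective _≡_ _≡_ f → a ≤ b
injection⇒≤ X↔a Y↔b f f-inj = injective⇒≤ {f = to Y↔b ∘ f ∘ from X↔a}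
  (λ {i} {j} eq → trans (sym (strictlyInverseˡ X↔a i))
     (trans (cong (to X↔a) (f-inj (Injection.injective (↔⇒↣ Y↔b) eq)))
            (strictlyInverseˡ X↔a j)))
  where open Inverse

2^⌊log2⌋≤ : ∀ m (rec : Acc _<_ (suc m)) → 2 ^ ⌊log2⌋ (suc m) rec ≤ suc m
2^⌊log2⌋≤ zero    _       = ≤-refl
2^⌊log2⌋≤ (suc k) (acc _) = begin
    2 * 2 ^ ⌊log2⌋ (suc ⌊ k /2⌋) _  ≤⟨ *-monoʳ-≤ 2 (2^⌊log2⌋≤ ⌊ k /2⌋ _) ⟩
    2 * suc ⌊ k /2⌋                 ≡⟨ cong suc (+-suc ⌊ k /2⌋ (⌊ k /2⌋ + 0)) ⟩
    suc (suc (⌊ k /2⌋ + (⌊ k /2⌋ + 0)))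
      ≤⟨ s≤s (s≤s (+-monoʳ-≤ ⌊ k /2⌋ (≤-trans (≤-reflexive (+-identityʳ _)) (⌊n/2⌋≤⌈n/2⌉ k)))) ⟩
    suc (suc (⌊ k /2⌋ + ⌈ k /2⌉))   ≡⟨ cong (λ x → suc (suc x)) (⌊n/2⌋+⌈n/2⌉≡n k) ⟩
    suc (suc k)                     ∎
  where open ≤-Reasoning

2^⌊log₂⌋≤ : ∀ m → 1 ≤ m → 2 ^ ⌊log₂ m ⌋ ≤ m
2^⌊log₂⌋≤ (suc m) _ = 2^⌊log2⌋≤ m (<-wellFounded (suc m))

≤⌊log₂⌋ : ∀ k m → 2 ^ k ≤ m → k ≤ ⌊log₂ m ⌋
≤⌊log₂⌋ k m 2^k≤m = ≤-trans (≤-reflexive (sym (⌊log₂[2^n]⌋≡n k))) (⌊log₂⌋-mono-≤ 2^k≤m)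

nth-zero : ∀ {A : Set} (xs : List A) → nth xs 0 ≡ nothing
nth-zero []      = refl
nth-zero (_ ∷ _) = refl

nth-∈ : ∀ {A : Set} (xs : List A) j {x} → nth xs j ≡ just x → x ∈ xs
nth-∈ (y ∷ xs) 1             refl = here refl
nth-∈ (y ∷ xs) (suc (suc j)) e    = there (nth-∈ xs (suc j) e)

∈⇒nth : ∀ {A : Set} (xs : List A) {x} → x ∈ xs → ∃[ j ] nth xs (suc j) ≡ just x
∈⇒nth (y ∷ xs) (here refl)  = 0 , refl
∈⇒nth (y ∷ xs) (there x∈xs) = let (j , e) = ∈⇒nth xs x∈xs in suc j , e

nth-just⇒≤ : ∀ {A : Set} (xs : List A) j {x} → nth xs j ≡ just x → j ≤ length xs
nth-just⇒≤ (y ∷ xs) 1             refl = s≤s z≤n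
nth-just⇒≤ (y ∷ xs) (suc (suc j)) e    = s≤s (nth-just⇒≤ xs (suc j) e)

nth-nothing⇒> : ∀ {A : Set} (xs : List A) j → 1 ≤ j → nth xs j ≡ nothing → length xs < j
nth-nothing⇒> []       (suc j)       _ _ = s≤s z≤n
nth-nothing⇒> (y ∷ xs) 1             _ ()
nth-nothing⇒> (y ∷ xs) (suc (suc j)) _ e = s≤s (nth-nothing⇒> xs (suc j) (s≤s z≤n) e)

-- Dialogues: programs that ask cheap questions (from Q, answered in S) and
-- read values (at places in P, answered in V).  The decoder is such a
-- program; it is run once against s (to produce the advice) and once against
-- recorded answers (to decode).
module Dialogues (Q S P V : Set) where

  data Dialogue (X : Set) : Set where
    return : X → Dialogue X
    ask    : Q → (S → Dialogue X) → Dialogue X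
    read   : P → (V → Dialogue X) → Dialogue X

  _>>=_ : ∀ {X Y} → Dialogue X → (X → Dialogue Y) → Dialogue Y
  return x >>= f = f x
  ask q k  >>= f = ask q (λ a → k a >>= f)
  read p k >>= f = read p (λ v → k v >>= f)

  replay : ∀ {X} → Dialogue X → List S → List V → Maybe X
  replay (return x) _        _        = just x
  replay (ask q k)  []       _        = nothing
  replay (ask q k)  (a ∷ as) vs       = replay (k a) as vs
  replay (read p k) _        []       = nothing
  replay (read p k) as       (v ∷ vs) = replay (k v) as vs

  module Answering (answer : Q → S) (value : P → V) where

    record Transcript (X : Set) : Set where
      constructor transcript
      field
        result  : X
        answers : List S
        values  : List V
    open Transcript public

    play : ∀ {X} → Dialogue X → Transcript X
    play (return x) = transcript x [] []
    play (ask q k)  = let T = play (k (answer q)) in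
                      transcript (result T) (answer q ∷ answers T) (values T)
    play (read p k) = let T = play (k (value p)) in
                      transcript (result T) (answers T) (value p ∷ values T)

    replay-play : ∀ {X} (d : Dialogue X) as vs →
      replay d (answers (play d) ++ as) (values (play d) ++ vs) ≡ just (result (play d))
    replay-play (return x) as vs = refl
    replay-play (ask q k)  as vs = replay-play (k (answer q)) as vs
    replay-play (read p k) as vs = replay-play (k (value p)) as vs

    -- Spec R d: the answered run of d ends with a result x after a cheap
    -- answers and b values such that R x a b.
    Spec : ∀ {X} → (X → ℕ → ℕ → Set) → Dialogue X → Set
    Spec R (return x) = R x 0 0
    Spec R (ask q k)  = Spec (λ x a b → R x (suc a) b) (k (answer q))
    Spec R (read p k) = Spec (λ x a b → R x a (suc b)) (k (value p))

    spec-play : ∀ {X} {R : X → ℕ → ℕ → Set} (d : Dialogue X) → Spec R d →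
      R (result (play d)) (length (answers (play d))) (length (values (play d)))
    spec-play (return x) r = r
    spec-play (ask q k)  r = spec-play (k (answer q)) r
    spec-play (read p k) r = spec-play (k (value p)) r

    spec-weaken : ∀ {X} {R R′ : X → ℕ → ℕ → Set} →
      (∀ {x a b} → R x a b → R′ x a b) → (d : Dialogue X) → Spec R d → Spec R′ d
    spec-weaken R⇒R′ (return x) r = R⇒R′ r
    spec-weaken R⇒R′ (ask q k)  r = spec-weaken R⇒R′ (k (answer q)) r
    spec-weaken R⇒R′ (read p k) r = spec-weaken R⇒R′ (k (value p)) r

    spec->>= : ∀ {X Y} {R : X → ℕ → ℕ → Set} {R′ : Y → ℕ → ℕ → Set}
      (d : Dialogue X) (f : X → Dialogue Y) → Spec R d →
      (∀ {x a b} → R x a b → Spec (λ y c e → R′ y (a + c) (b + e)) (f x)) →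
      Spec R′ (d >>= f)
    spec->>= (return x) f r rf = rf r
    spec->>= (ask q k)  f r rf = spec->>= (k (answer q)) f r rf
    spec->>= (read p k) f r rf = spec->>= (k (value p)) f r rf

module Partial {A : Set} where

  -- Number of unknown entries; it serves as the potential paying for reads.
  unknowns : ∀ {m} → Vec (Maybe A) m → ℕ
  unknowns []            = 0
  unknowns (nothing ∷ K) = suc (unknowns K)
  unknowns (just _ ∷ K)  = unknowns K

  unknowns-blank : ∀ m → unknowns (replicate m nothing) ≡ m
  unknowns-blank zero    = refl
  unknowns-blank (suc m) = cong suc (unknowns-blank m)

  unknowns-learn : ∀ {m} (K : Vec (Maybe A) m) i v → lookup K i ≡ nothing →
    suc (unknowns (K [ i ]≔ just v)) ≡ unknowns K
  unknowns-learn (nothing ∷ K) zero    v e = refl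
  unknowns-learn (nothing ∷ K) (suc i) v e = cong suc (unknowns-learn K i v e)
  unknowns-learn (just _ ∷ K)  (suc i) v e = unknowns-learn K i v e

  unknowns-relearn : ∀ {m} (K : Vec (Maybe A) m) i v {w} → lookup K i ≡ just w →
    unknowns (K [ i ]≔ just v) ≡ unknowns K
  unknowns-relearn (just _ ∷ K)  zero    v e = refl
  unknowns-relearn (nothing ∷ K) (suc i) v e = cong suc (unknowns-relearn K i v e)
  unknowns-relearn (just _ ∷ K)  (suc i) v e = unknowns-relearn K i v e

  module Relative {m} (s : Vec A m) where

    Known : Vec (Maybe A) m → Fin m → Set
    Known K i = lookup K i ≡ just (lookup s i)

    Sound : Vec (Maybe A) m → Set
    Sound K = ∀ i {v} → lookup K i ≡ just v → v ≡ lookup s i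

    _⊑_ : Vec (Maybe A) m → Vec (Maybe A) m → Set
    K ⊑ K′ = ∀ i → Known K i → Known K′ i

    sound-known : ∀ {K} → Sound K → ∀ i {v} → lookup K i ≡ just v → Known K i
    sound-known K-sound i e = trans e (cong just (K-sound i e))

    blank-sound : Sound (replicate m nothing)
    blank-sound i e with () ← trans (sym (lookup-replicate i nothing)) e

    learn-known : ∀ K i → Known (K [ i ]≔ just (lookup s i)) i
    learn-known K i = lookup∘update i K _

    learn-⊑ : ∀ K i → K ⊑ (K [ i ]≔ just (lookup s i))
    learn-⊑ K i j j-known with i ≟F j
    ... | yes refl = learn-known K i
    ... | no i≢j   = trans (lookup∘update′ (i≢j ∘ sym) K _) j-known

    learn-sound : ∀ {K} → Sound K → ∀ i → Sound (K [ i ]≔ just (lookup s i))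
    learn-sound {K} K-sound i j e with i ≟F j
    ... | yes refl = just-injective (trans (sym e) (learn-known K i))
    ... | no i≢j   = K-sound j (trans (sym (lookup∘update′ (i≢j ∘ sym) K _)) e)

indicator : ∀ {m} → Fin m → Fin m → ℕ
indicator d c = if does (d ≟F c) then 1 else 0

∑-indicator : ∀ {m} (d : Fin m) → ∑[ c < m ] indicator d c ≡ 1
∑-indicator {suc m} zero    = cong suc (sum-replicate-zero m)
∑-indicator {suc m} (suc d) = ∑-indicator d

module Occurrences {σ n} (s : Str σ n) where

  occurrences : Fin σ → List (Fin n)
  occurrences c = filter (λ i → lookup s i ≟F c) (allFin n)

  count : Fin σ → ℕ
  count c = length (occurrences c)

  count≤n : ∀ c → count c ≤ n
  count≤n c = ≤-trans (length-filter (λ i → lookup s i ≟F c) (allFin n))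
                      (≤-reflexive (length-tabulate id))

  select-char : ∀ c j {p} → select s c j ≡ just p → lookup s p ≡ c
  select-char c j e =
    proj₂ (∈-filter⁻ (λ i → lookup s i ≟F c) {xs = allFin n} (nth-∈ (occurrences c) j e))

  select-onto : ∀ c p → lookup s p ≡ c → ∃[ j ] select s c (suc j) ≡ just p
  select-onto c p e = ∈⇒nth (occurrences c) (∈-filter⁺ (λ i → lookup s i ≟F c) (∈-allFin p) e)

  select-zero : ∀ c → select s c 0 ≡ nothing
  select-zero c = nth-zero (occurrences c)

  select-rank : ∀ c j {p} → select s c j ≡ just p → j ≤ count c
  select-rank c = nth-just⇒≤ (occurrences c)

  select-end : ∀ c j → 1 ≤ j → select s c j ≡ nothing → count c < j
  select-end c = nth-nothing⇒> (occurrences c)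

  private
    length-filter-∷ : ∀ c x xs →
      length (filter (λ i → lookup s i ≟F c) (x ∷ xs)) ≡
      indicator (lookup s x) c + length (filter (λ i → lookup s i ≟F c) xs)
    length-filter-∷ c x xs with does (lookup s x ≟F c)
    ... | true  = refl
    ... | false = refl

    ∑-filter : ∀ xs → ∑[ c < σ ] length (filter (λ i → lookup s i ≟F c) xs) ≡ length xs
    ∑-filter []       = sum-replicate-zero σ
    ∑-filter (x ∷ xs) = begin
      ∑[ c < σ ] length (filter (λ i → lookup s i ≟F c) (x ∷ xs))
        ≡⟨ sum-cong-≗ (λ c → length-filter-∷ c x xs) ⟩
      ∑[ c < σ ] (indicator (lookup s x) c + length (filter (λ i → lookup s i ≟F c) xs))
        ≡⟨ ∑-distrib-+ (indicator (lookup s x)) _ ⟩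
      ∑[ c < σ ] indicator (lookup s x) c + ∑[ c < σ ] length (filter (λ i → lookup s i ≟F c) xs)
        ≡⟨ cong₂ _+_ (∑-indicator (lookup s x)) (∑-filter xs) ⟩
      suc (length xs) ∎
      where open ≡-Reasoning

  count-total : ∑[ c < σ ] count c ≡ n
  count-total = trans (∑-filter (allFin n)) (length-tabulate id)

Knowledge : ℕ → ℕ → Set
Knowledge σ n = Vec (Maybe (Fin σ)) n

data Question (σ n : ℕ) : Set where
  -- Is there no j-th occurrence of c (0F), one whose position is known in K
  -- (1F), or one whose position is unknown in K (2F)?
  rank? : Fin σ → ℕ → Knowledge σ n → Question σ n
  -- Is s[i] = c (0F) or not (1F)?
  is?   : Fin σ → Fin n → Question σ n

module Decoder {σ n t} (query : Fin σ → ℕ → Probes σ n (Maybe (Fin n)) t) where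

  open Dialogues (Question σ n) (Fin 3) (Fin n) (Fin σ) public

  simulate : ∀ {m} → Fin σ → Probes σ n (Maybe (Fin n)) m → Knowledge σ n →
             Dialogue (Knowledge σ n × Maybe (Fin n))
  simulate c (done a)    K = return (K , a)
  simulate c (probe i k) K with lookup K i
  ... | just v  = simulate c (k v) K
  ... | nothing = ask (is? c i) λ where
    0F → simulate c (k c) (K [ i ]≔ just c)
    _  → read i λ v → simulate c (k v) (K [ i ]≔ just v)

  record-answer : Fin σ → Knowledge σ n × Maybe (Fin n) → Knowledge σ n
  record-answer c (K , nothing) = K
  record-answer c (K , just p)  = K [ p ]≔ just c

  visit : ℕ → Fin σ → ℕ → Knowledge σ n → Dialogue (Knowledge σ n)
  visit zero    c j K = return K
  visit (suc f) c j K = ask (rank? c j K) λ where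
    0F → return K
    1F → visit f c (suc j) K
    _  → simulate c (query c j) K >>= (visit f c (suc j) ∘ record-answer c)

  decode-chars : ∀ m → (Fin m → Fin σ) → Knowledge σ n → Dialogue (Knowledge σ n)
  decode-chars zero    χ K = return K
  decode-chars (suc m) χ K = visit (suc n) (χ zero) 1 K >>= decode-chars m (χ ∘ suc)

  decode : Dialogue (Knowledge σ n)
  decode = decode-chars σ id (replicate n nothing)

rank-answer : ∀ {σ n} → Knowledge σ n → Maybe (Fin n) → Fin 3
rank-answer K nothing  = 0F
rank-answer K (just p) with lookup K p
... | just _  = 1F
... | nothing = 2F

answer : ∀ {σ n} → Str σ n → Question σ n → Fin 3
answer s (rank? c j K) = rank-answer K (select s c j)
answer s (is? c i)     = if does (lookup s i ≟F c) then 0F else 1F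

-- Bookkeeping inequalities for the two costs of the decoder.  Reads are paid
-- with the potential t·(unknowns); cheap answers are bounded by ranks.

-- A query reading y ≤ t values and learning at least y + 1 entries pays
-- for its reads.
pay-query : ∀ t y u u′ → y ≤ t → suc y + u′ ≤ u → suc t * y + t * u′ ≤ t * u
pay-query t y u u′ y≤t learned = begin
  suc t * y + t * u′    ≡⟨ +-assoc y (t * y) (t * u′) ⟩
  y + (t * y + t * u′)  ≤⟨ +-monoˡ-≤ _ y≤t ⟩
  t + (t * y + t * u′)  ≡⟨ solve 3 (λ t y u′ → t :+ (t :* y :+ t :* u′) := t :* (con 1 :+ y :+ u′)) refl t y u′ ⟩
  t * (suc y + u′)      ≤⟨ *-monoʳ-≤ t learned ⟩
  t * u                 ∎
  where open ≤-Reasoning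

pay-chain : ∀ a t y₁ y₂ u₀ u₁ u₂ → a * y₁ + t * u₁ ≤ t * u₀ → a * y₂ + t * u₂ ≤ t * u₁ →
            a * (y₁ + y₂) + t * u₂ ≤ t * u₀
pay-chain a t y₁ y₂ u₀ u₁ u₂ first second = begin
  a * (y₁ + y₂) + t * u₂    ≡⟨ solve 5 (λ a t y₁ y₂ u₂ → a :* (y₁ :+ y₂) :+ t :* u₂ := a :* y₁ :+ (a :* y₂ :+ t :* u₂)) refl a t y₁ y₂ u₂ ⟩
  a * y₁ + (a * y₂ + t * u₂) ≤⟨ +-monoʳ-≤ (a * y₁) second ⟩
  a * y₁ + t * u₁            ≤⟨ first ⟩
  t * u₀                     ∎
  where open ≤-Reasoning

-- Cheap answers of a visit step that runs a query (x₁ answers, learning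
-- entries) and then continues at the next rank.
answers-step : ∀ L j x₁ x₂ u₀ u₁ u₂ → x₁ + u₁ ≤ u₀ → x₂ + u₂ + suc j ≤ L + u₁ →
               suc (x₁ + x₂) + u₂ + j ≤ L + u₀
answers-step L j x₁ x₂ u₀ u₁ u₂ query rest = begin
  suc (x₁ + x₂) + u₂ + j   ≡⟨ solve 4 (λ x₁ x₂ u₂ j → con 1 :+ (x₁ :+ x₂) :+ u₂ :+ j := x₁ :+ (x₂ :+ u₂ :+ (con 1 :+ j))) refl x₁ x₂ u₂ j ⟩
  x₁ + (x₂ + u₂ + suc j)   ≤⟨ +-monoʳ-≤ x₁ rest ⟩
  x₁ + (L + u₁)            ≡⟨ solve 3 (λ x₁ L u₁ → x₁ :+ (L :+ u₁) := L :+ (x₁ :+ u₁)) refl x₁ L u₁ ⟩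
  L + (x₁ + u₁)            ≤⟨ +-monoʳ-≤ L query ⟩
  L + u₀                   ∎
  where open ≤-Reasoning

-- Cheap answers of one character (visit from rank 1) followed by the others.
answers-chars : ∀ L S x₁ x₂ u₀ u₁ u₂ → x₁ + u₁ + 1 ≤ L + 2 + u₀ → x₂ + u₂ ≤ S + u₁ →
                x₁ + x₂ + u₂ ≤ suc L + S + u₀
answers-chars L S x₁ x₂ u₀ u₁ u₂ char rest = +-cancelʳ-≤ 1 _ _ (begin
  x₁ + x₂ + u₂ + 1     ≡⟨ solve 3 (λ x₁ x₂ u₂ → x₁ :+ x₂ :+ u₂ :+ con 1 := x₁ :+ (x₂ :+ u₂) :+ con 1) refl x₁ x₂ u₂ ⟩
  x₁ + (x₂ + u₂) + 1   ≤⟨ +-monoˡ-≤ 1 (+-monoʳ-≤ x₁ rest) ⟩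
  x₁ + (S + u₁) + 1    ≡⟨ solve 3 (λ x₁ S u₁ → x₁ :+ (S :+ u₁) :+ con 1 := S :+ (x₁ :+ u₁ :+ con 1)) refl x₁ S u₁ ⟩
  S + (x₁ + u₁ + 1)    ≤⟨ +-monoʳ-≤ S char ⟩
  S + (L + 2 + u₀)     ≡⟨ solve 3 (λ S L u₀ → S :+ (L :+ con 2 :+ u₀) := con 1 :+ L :+ S :+ u₀ :+ con 1) refl S L u₀ ⟩
  suc L + S + u₀ + 1   ∎)
  where open ≤-Reasoning

module Analysis {σ n t r} (I : SelectIndex σ n t r) (s : Str σ n) where

  open SelectIndex I renaming (correct to query-correct)
  open Decoder (query (index s))
  open Answering (answer s) (lookup s)
  open Occurrences s
  open Partial
  open Relative s

  record Simulated (K : Knowledge σ n) (c : Fin σ) (m : ℕ) (a : Maybe (Fin n))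
                   (out : Knowledge σ n × Maybe (Fin n)) (x y : ℕ) : Set where
    field
      sound   : Sound (proj₁ out)
      grows   : K ⊑ proj₁ out
      correct : proj₂ out ≡ a
      -- every flag learns a new entry
      flags   : x + unknowns (proj₁ out) ≡ unknowns K
      reads≤probes : y ≤ m
      reads≤flags  : y ≤ x
      -- an entry holding c is learned by a flag, without a read
      fresh   : ∀ p → lookup K p ≡ nothing → lookup s p ≡ c → Known (proj₁ out) p → suc y ≤ x

  private
    nothing≢just : ∀ {A B : Set} {v : A} → nothing ≡ just v → B
    nothing≢just ()

  probe-known : ∀ {K c m a out x y} →
    Simulated K c m a out x y → Simulated K c (suc m) a out x y
  probe-known S = record
    { sound = sound ; grows = grows ; correct = correct ; flags = flags
    ; reads≤probes = m≤n⇒m≤1+n reads≤probes ; reads≤flags = reads≤flags ; fresh = fresh }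
    where open Simulated S

  flag-hit : ∀ {K m a out x y} i → lookup K i ≡ nothing →
    Simulated (K [ i ]≔ just (lookup s i)) (lookup s i) m a out x y →
    Simulated K (lookup s i) (suc m) a out (suc x) y
  flag-hit {K} {out = out} {x} {y} i i-unknown S = record
    { sound = sound ; grows = λ j j-known → grows j (learn-⊑ K i j j-known) ; correct = correct
    ; flags = trans (cong suc flags) (unknowns-learn K i _ i-unknown)
    ; reads≤probes = m≤n⇒m≤1+n reads≤probes ; reads≤flags = m≤n⇒m≤1+n reads≤flags
    ; fresh = fresh′ }
    where
    open Simulated S
    fresh′ : ∀ p → lookup K p ≡ nothing → lookup s p ≡ lookup s i → Known (proj₁ out) p → suc y ≤ suc x
    fresh′ p p-unknown p-char p-known with i ≟F p
    ... | yes refl = s≤s reads≤flags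
    ... | no i≢p   = m≤n⇒m≤1+n (fresh p (trans (lookup∘update′ (i≢p ∘ sym) K _) p-unknown) p-char p-known)

  flag-miss : ∀ {K c m a out x y} i → lookup K i ≡ nothing → lookup s i ≢ c →
    Simulated (K [ i ]≔ just (lookup s i)) c m a out x y →
    Simulated K c (suc m) a out (suc x) (suc y)
  flag-miss {K} {c} {out = out} {x} {y} i i-unknown i≢c S = record
    { sound = sound ; grows = λ j j-known → grows j (learn-⊑ K i j j-known) ; correct = correct
    ; flags = trans (cong suc flags) (unknowns-learn K i _ i-unknown)
    ; reads≤probes = s≤s reads≤probes ; reads≤flags = s≤s reads≤flags
    ; fresh = fresh′ }
    where
    open Simulated S
    fresh′ : ∀ p → lookup K p ≡ nothing → lookup s p ≡ c → Known (proj₁ out) p → suc (suc y) ≤ suc x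
    fresh′ p p-unknown p-char p-known with i ≟F p
    ... | yes refl = ⊥-elim (i≢c p-char)
    ... | no i≢p   = s≤s (fresh p (trans (lookup∘update′ (i≢p ∘ sym) K _) p-unknown) p-char p-known)

  simulate-spec : ∀ {m} c (T : Probes σ n (Maybe (Fin n)) m) K → Sound K →
                  Spec (Simulated K c m (run s T)) (simulate c T K)
  simulate-spec c (done a) K K-sound = record
    { sound = K-sound ; grows = λ _ known → known ; correct = refl ; flags = refl
    ; reads≤probes = z≤n ; reads≤flags = z≤n
    ; fresh = λ p p-unknown _ p-known → nothing≢just (trans (sym p-unknown) p-known) }
  simulate-spec c (probe i k) K K-sound with lookup K i in i-entry
  ... | just v with refl ← K-sound i i-entry =
    spec-weaken probe-known (simulate c (k v) K) (simulate-spec c (k v) K K-sound)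
  ... | nothing with lookup s i ≟F c
  ...   | yes refl = spec-weaken (flag-hit i i-entry) (simulate c (k c) K′)
                       (simulate-spec c (k c) K′ (learn-sound {K} K-sound i))
    where K′ : Knowledge σ n
          K′ = K [ i ]≔ just (lookup s i)
  ...   | no i≢c   = spec-weaken (flag-miss i i-entry i≢c) (simulate c (k (lookup s i)) K′)
                       (simulate-spec c (k (lookup s i)) K′ (learn-sound {K} K-sound i))
    where K′ : Knowledge σ n
          K′ = K [ i ]≔ just (lookup s i)

  record-cost : ∀ {K m a out x y} p → lookup K p ≡ nothing →
    Simulated K (lookup s p) m a out x y →
    (suc y + unknowns (proj₁ out [ p ]≔ just (lookup s p)) ≤ unknowns K) ×
    (x + unknowns (proj₁ out [ p ]≔ just (lookup s p)) ≤ unknowns K)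
  record-cost {K} {out = K′ , _} {x} {y} p p-unknown S with lookup K′ p in p-entry
  ... | nothing =
      (begin
        suc y + unknowns K″      ≡⟨ +-suc y _ ⟨
        y + suc (unknowns K″)    ≡⟨ cong (y +_) (unknowns-learn K′ p _ p-entry) ⟩
        y + unknowns K′          ≤⟨ +-monoˡ-≤ _ reads≤flags ⟩
        x + unknowns K′          ≡⟨ flags ⟩
        unknowns K               ∎)
    , (begin
        x + unknowns K″          ≤⟨ +-monoʳ-≤ x (n≤1+n _) ⟩
        x + suc (unknowns K″)    ≡⟨ cong (x +_) (unknowns-learn K′ p _ p-entry) ⟩
        x + unknowns K′          ≡⟨ flags ⟩
        unknowns K               ∎)
    where
    open Simulated S
    open ≤-Reasoning
    K″ : Knowledge σ n
    K″ = K′ [ p ]≔ just (lookup s p)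
  ... | just w =
      (begin
        suc y + unknowns K″      ≡⟨ cong (suc y +_) (unknowns-relearn K′ p _ p-entry) ⟩
        suc y + unknowns K′      ≤⟨ +-monoˡ-≤ _ (fresh p p-unknown refl (sound-known {K′} sound p p-entry)) ⟩
        x + unknowns K′          ≡⟨ flags ⟩
        unknowns K               ∎)
    , ≤-reflexive (trans (cong (x +_) (unknowns-relearn K′ p _ p-entry)) flags)
    where
    open Simulated S
    open ≤-Reasoning
    K″ : Knowledge σ n
    K″ = K′ [ p ]≔ just (lookup s p)

  Below : Knowledge σ n → Fin σ → ℕ → Set
  Below K c j = ∀ j′ {p} → j′ < j → select s c j′ ≡ just p → Known K p

  below-start : ∀ K c → Below K c 1
  below-start K c zero     _          e with () ← trans (sym (select-zero c)) e
  below-start K c (suc j′) (s≤s ()) _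

  below-step : ∀ K {c j p} → Below K c j → select s c j ≡ just p → Known K p → Below K c (suc j)
  below-step K below e p-known j′ j′<1+j e′ with m<1+n⇒m<n∨m≡n j′<1+j
  ... | inj₁ j′<j = below j′ j′<j e′
  ... | inj₂ refl with refl ← trans (sym e) e′ = p-known

  record Visited (K : Knowledge σ n) (c : Fin σ) (j : ℕ) (K′ : Knowledge σ n) (x y : ℕ) : Set where
    field
      sound       : Sound K′
      grows       : K ⊑ K′
      complete    : ∀ p → lookup s p ≡ c → Known K′ p
      read-cost   : suc t * y + t * unknowns K′ ≤ t * unknowns K
      answer-cost : x + unknowns K′ + j ≤ count c + 2 + unknowns K

  -- No occurrence of rank j: all occurrences have smaller rank and are known.
  visit-end : ∀ {c j} K → Sound K → Below K c j → 1 ≤ j → j ≤ suc (count c) →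
              select s c j ≡ nothing → Visited K c j K 1 0
  visit-end {c} {j} K K-sound below 1≤j j≤1+count e = record
    { sound = K-sound ; grows = λ _ known → known ; complete = complete
    ; read-cost = ≤-reflexive (cong (_+ t * unknowns K) (*-zeroʳ (suc t)))
    ; answer-cost = ≤-trans (≤-reflexive (cong suc (+-comm (unknowns K) j)))
        (+-monoˡ-≤ (unknowns K) (≤-trans (s≤s j≤1+count) (≤-reflexive (+-comm 2 (count c))))) }
    where
    complete : ∀ p → lookup s p ≡ c → Known K p
    complete p p-char = let (j′ , e′) = select-onto c p p-char in
      below (suc j′) (<-≤-trans (s≤s (select-rank c (suc j′) e′)) (select-end c j 1≤j e)) e′

  visit-skip : ∀ {K c j K′ x y} → Visited K c (suc j) K′ x y → Visited K c j K′ (suc x) y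
  visit-skip {j = j} {K′ = K′} {x = x} V = record
    { sound = sound ; grows = grows ; complete = complete ; read-cost = read-cost
    ; answer-cost = ≤-trans (≤-reflexive (sym (+-suc (x + unknowns K′) j))) answer-cost }
    where open Visited V

  visit-spec : ∀ f c j K → Sound K → Below K c j → 1 ≤ j → j ≤ suc (count c) →
               count c + 2 ≤ f + j → Spec (Visited K c j) (visit f c j K)

  visit-query : ∀ f j K p → let c = lookup s p in
    Sound K → Below K c j → count c + 2 ≤ f + suc j →
    select s c j ≡ just p → lookup K p ≡ nothing →
    Spec (λ K′ a b → Visited K c j K′ (suc a) b)
         (simulate c (query (index s) c j) K >>= (visit f c (suc j) ∘ record-answer c))
  visit-query f j K p K-sound below fuel e p-unknown =
    spec->>= (simulate c (query (index s) c j) K) (visit f c (suc j) ∘ record-answer c)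
             (simulate-spec c (query (index s) c j) K K-sound) continue
    where
    c : Fin σ
    c = lookup s p
    continue : ∀ {out a b} → Simulated K c t (run s (query (index s) c j)) out a b →
      Spec (λ K′ a′ b′ → Visited K c j K′ (suc (a + a′)) (b + b′))
           (visit f c (suc j) (record-answer c out))
    continue {K′ , ans} {a} {b} S with trans (Simulated.correct S) (trans (query-correct s c j) e)
    ... | refl = spec-weaken combine (visit f c (suc j) K″)
                   (visit-spec f c (suc j) K″ (learn-sound {K′} (Simulated.sound S) p)
                      (below-step K″ (λ j′ j′<j e′ → learn-⊑ K′ p _ (Simulated.grows S _ (below j′ j′<j e′)))
                                  e (learn-known K′ p))
                      (s≤s z≤n) (s≤s (select-rank c j e)) fuel)
      where
      K″ : Knowledge σ n
      K″ = K′ [ p ]≔ just c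
      costs : (suc b + unknowns K″ ≤ unknowns K) × (a + unknowns K″ ≤ unknowns K)
      costs = record-cost p p-unknown S
      combine : ∀ {K‴ x y} → Visited K″ c (suc j) K‴ x y → Visited K c j K‴ (suc (a + x)) (b + y)
      combine {K‴} {x} {y} V = record
        { sound = sound ; complete = complete
        ; grows = λ i known → grows i (learn-⊑ K′ p i (Simulated.grows S i known))
        ; read-cost = pay-chain (suc t) t b y (unknowns K) (unknowns K″) (unknowns K‴)
            (pay-query t b (unknowns K) (unknowns K″) (Simulated.reads≤probes S) (proj₁ costs))
            read-cost
        ; answer-cost = answers-step (count c + 2) j a x (unknowns K) (unknowns K″) (unknowns K‴)
            (proj₂ costs) answer-cost }
        where open Visited V

  visit-spec zero c j K _ _ _ j≤1+count fuel =
    ⊥-elim (1+n≰n (≤-trans (≤-reflexive (+-comm 2 (count c))) (≤-trans fuel j≤1+count)))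
  visit-spec (suc f) c j K K-sound below 1≤j j≤1+count fuel with select s c j in e
  ... | nothing = visit-end K K-sound below 1≤j j≤1+count e
  ... | just p with lookup K p in p-entry
  ...   | just w = spec-weaken visit-skip (visit f c (suc j) K)
            (visit-spec f c (suc j) K K-sound (below-step K below e (sound-known {K} K-sound p p-entry))
                        (s≤s z≤n) (s≤s (select-rank c j e)) fuel′)
    where fuel′ : count c + 2 ≤ f + suc j
          fuel′ = ≤-trans fuel (≤-reflexive (sym (+-suc f j)))
  ...   | nothing with refl ← select-char c j e =
            visit-query f j K p K-sound below (≤-trans fuel (≤-reflexive (sym (+-suc f j)))) e p-entry

  record Decoded (K : Knowledge σ n) (m : ℕ) (χ : Fin m → Fin σ) (K′ : Knowledge σ n) (x y : ℕ) : Set where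
    field
      sound       : Sound K′
      grows       : K ⊑ K′
      complete    : ∀ k p → lookup s p ≡ χ k → Known K′ p
      read-cost   : suc t * y + t * unknowns K′ ≤ t * unknowns K
      answer-cost : x + unknowns K′ ≤ ∑[ k < m ] suc (count (χ k)) + unknowns K

  decode-chars-spec : ∀ m χ K → Sound K → Spec (Decoded K m χ) (decode-chars m χ K)
  decode-chars-spec zero χ K K-sound = record
    { sound = K-sound ; grows = λ _ known → known ; complete = λ ()
    ; read-cost = ≤-reflexive (cong (_+ t * unknowns K) (*-zeroʳ (suc t))) ; answer-cost = ≤-refl }
  decode-chars-spec (suc m) χ K K-sound =
    spec->>= {R′ = Decoded K (suc m) χ} (visit (suc n) (χ zero) 1 K) (decode-chars m (χ ∘ suc))
      (visit-spec (suc n) (χ zero) 1 K K-sound (below-start K (χ zero)) (s≤s z≤n) (s≤s z≤n) fuel)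
      (λ V → spec-weaken (combine V) (decode-chars m (χ ∘ suc) _)
                         (decode-chars-spec m (χ ∘ suc) _ (Visited.sound V)))
    where
    fuel : count (χ zero) + 2 ≤ suc n + 1
    fuel = ≤-trans (+-monoˡ-≤ 2 (count≤n (χ zero))) (≤-reflexive (+-suc n 1))
    combine : ∀ {K₁ x₁ y₁ K₂ x₂ y₂} → Visited K (χ zero) 1 K₁ x₁ y₁ →
              Decoded K₁ m (χ ∘ suc) K₂ x₂ y₂ → Decoded K (suc m) χ K₂ (x₁ + x₂) (y₁ + y₂)
    combine {K₁} {x₁} {y₁} {K₂} {x₂} {y₂} V D = record
      { sound = Decoded.sound D
      ; grows = λ i known → Decoded.grows D i (Visited.grows V i known)
      ; complete = λ where
          zero    p p-char → Decoded.grows D p (Visited.complete V p p-char)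
          (suc k) p p-char → Decoded.complete D k p p-char
      ; read-cost = pay-chain (suc t) t y₁ y₂ (unknowns K) (unknowns K₁) (unknowns K₂)
                      (Visited.read-cost V) (Decoded.read-cost D)
      ; answer-cost = answers-chars (count (χ zero)) _ x₁ x₂ (unknowns K) (unknowns K₁) (unknowns K₂)
                        (Visited.answer-cost V) (Decoded.answer-cost D) }

  private
    ∑-one : ∀ m → ∑[ k < m ] 1 ≡ m
    ∑-one zero    = refl
    ∑-one (suc m) = cong suc (∑-one m)

    decoded : Decoded (replicate n nothing) σ id (result (play decode))
                      (length (answers (play decode))) (length (values (play decode)))
    decoded = spec-play decode (decode-chars-spec σ id (replicate n nothing) blank-sound)

  decode-result : ∀ p → lookup (result (play decode)) p ≡ just (lookup s p)
  decode-result p = Decoded.complete decoded (lookup s p) p refl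

  answers-bound : length (answers (play decode)) ≤ σ + n + n
  answers-bound = begin
    length (answers (play decode))                      ≤⟨ m≤m+n _ _ ⟩
    length (answers (play decode)) + unknowns K         ≤⟨ Decoded.answer-cost decoded ⟩
    ∑[ c < σ ] suc (count c) + unknowns (replicate n nothing)
      ≡⟨ cong₂ _+_ (trans (∑-distrib-+ (λ _ → 1) count) (cong₂ _+_ (∑-one σ) count-total))
                   (unknowns-blank n) ⟩
    σ + n + n                                           ∎
    where
    open ≤-Reasoning
    K : Knowledge σ n
    K = result (play decode)

  values-bound : suc t * length (values (play decode)) ≤ t * n
  values-bound = begin
    suc t * length (values (play decode))                                  ≤⟨ m≤m+n _ _ ⟩
    suc t * length (values (play decode)) + t * unknowns (result (play decode)) ≤⟨ Decoded.read-cost decoded ⟩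
    t * unknowns (replicate n nothing)                                     ≡⟨ cong (t *_) (unknowns-blank n) ⟩
    t * n                                                                  ∎
    where open ≤-Reasoning

Padding : ∀ {B : Set} → ℕ → List B → Set
Padding {B} a l = Σ (Vec B a) λ v → ∃[ rest ] Vec.toList v ≡ l ++ rest

pad : ∀ {B : Set} a → B → (l : List B) → length l ≤ a → Padding a l
pad zero    d []      _       = [] , [] , refl
pad (suc a) d []      _       = let (v , rest , e) = pad a d [] z≤n in d ∷ v , d ∷ rest , cong (d ∷_) e
pad (suc a) d (x ∷ l) (s≤s h) = let (v , rest , e) = pad a d l h in x ∷ v , rest , cong (x ∷_) e

module Encoding {σ n t r} (I : SelectIndex σ n t r) (default : Fin σ) where

  open SelectIndex I using (index; query)
  open Dialogues (Question σ n) (Fin 3) (Fin n) (Fin σ) using (replay)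

  -- Length of the value advice: a truthful run reads at most t·n/(t+1) values.
  reads : ℕ
  reads = t * n / suc t

  module Advice (s : Str σ n) where
    open Decoder (query (index s)) using (decode)
    open Decoder.Answering (query (index s)) (answer s) (lookup s)
    open Analysis I s public using (decode-result)
    open Analysis I s using (answers-bound; values-bound)

    reads-bound : length (values (play decode)) ≤ reads
    reads-bound = begin
      length (values (play decode))           ≡⟨ m*n/n≡m _ (suc t) ⟨
      length (values (play decode)) * suc t / suc t
        ≤⟨ /-monoˡ-≤ (suc t) (≤-trans (≤-reflexive (*-comm _ (suc t))) values-bound) ⟩
      reads                                   ∎
      where open ≤-Reasoning

    answer-advice : Padding (σ + n + n) (answers (play decode))
    answer-advice = pad (σ + n + n) 0F (answers (play decode)) answers-bound

    value-advice : Padding reads (values (play decode))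
    value-advice = pad reads default (values (play decode)) reads-bound

    recovered : Knowledge σ n
    recovered = result (play decode)

    replay-advice : replay decode (Vec.toList (proj₁ answer-advice))
                                  (Vec.toList (proj₁ value-advice)) ≡ just recovered
    replay-advice rewrite proj₂ (proj₂ answer-advice) | proj₂ (proj₂ value-advice) = replay-play decode _ _

  open Advice

  code : Str σ n → Vec Bool r × (Vec (Fin 3) (σ + n + n) × Vec (Fin σ) reads)
  code s = index s , proj₁ (answer-advice s) , proj₁ (value-advice s)

  code-injective : Injective _≡_ _≡_ code
  code-injective {s} {s′} same-code = Pointwise-≡⇒≡ (ext λ p → just-injective (begin
    just (lookup s p)         ≡⟨ decode-result s p ⟨
    lookup (recovered s) p    ≡⟨ cong (λ K → lookup K p) same-recovery ⟩
    lookup (recovered s′) p   ≡⟨ decode-result s′ p ⟩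
    just (lookup s′ p)        ∎))
    where
    open ≡-Reasoning
    decode-code : Vec Bool r × (Vec (Fin 3) (σ + n + n) × Vec (Fin σ) reads) → Maybe (Knowledge σ n)
    decode-code (i , as , vs) = replay (Decoder.decode (query i)) (Vec.toList as) (Vec.toList vs)
    same-recovery : recovered s ≡ recovered s′
    same-recovery = just-injective (trans (sym (replay-advice s))
                                   (trans (cong decode-code same-code) (replay-advice s′)))

  counting-bound : σ ^ n ≤ 2 ^ r * (3 ^ (σ + n + n) * σ ^ reads)
  counting-bound = injection⇒≤ (vec↔ n ↔-refl)
    (×↔ (vec↔ r (↔-sym 2↔Bool)) (×↔ (vec↔ (σ + n + n) ↔-refl) (vec↔ reads ↔-refl)))
    code code-injective

2^-cancel-≤ : ∀ x y → 2 ^ x ≤ 2 ^ y → x ≤ y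
2^-cancel-≤ x y 2^x≤2^y = ≮⇒≥ λ y<x → <⇒≱ (^-monoʳ-< 2 (s≤s (s≤s z≤n)) y<x) 2^x≤2^y

-- 3 ^ a ≤ 2 ^ (5n) when a ≤ 3n, as 27 ≤ 32.
3^≤2^ : ∀ a n → a ≤ 3 * n → 3 ^ a ≤ 2 ^ (5 * n)
3^≤2^ a n a≤3n = begin
  3 ^ a         ≤⟨ ^-monoʳ-≤ 3 a≤3n ⟩
  3 ^ (3 * n)   ≡⟨ ^-*-assoc 3 3 n ⟨
  27 ^ n        ≤⟨ ^-monoˡ-≤ n (≤ᵇ⇒≤ 27 32 _) ⟩
  32 ^ n        ≡⟨ ^-*-assoc 2 5 n ⟩
  2 ^ (5 * n)   ∎
  where open ≤-Reasoning

-- Taking logarithms in σ^n ≤ 2^r · 3^a · σ^A: the n - A characters not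
-- stored verbatim cost L = log σ bits each, paid by r plus O(n) bits.
exponent-bound : ∀ σ n r a A L .{{_ : NonZero σ}} → A ≤ n → 2 ^ L ≤ σ → a ≤ 3 * n →
  σ ^ n ≤ 2 ^ r * (3 ^ a * σ ^ A) → L * (n ∸ A) ≤ r + 5 * n
exponent-bound σ n r a A L A≤n 2^L≤σ a≤3n counting = 2^-cancel-≤ _ _ (begin
  2 ^ (L * D)          ≡⟨ ^-*-assoc 2 L D ⟨
  (2 ^ L) ^ D          ≤⟨ ^-monoˡ-≤ D 2^L≤σ ⟩
  σ ^ D                ≤⟨ unstored ⟩
  2 ^ r * 3 ^ a        ≤⟨ *-monoʳ-≤ (2 ^ r) (3^≤2^ a n a≤3n) ⟩
  2 ^ r * 2 ^ (5 * n)  ≡⟨ ^-distribˡ-+-* 2 r (5 * n) ⟨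
  2 ^ (r + 5 * n)      ∎)
  where
  open ≤-Reasoning
  D : ℕ
  D = n ∸ A
  unstored : σ ^ D ≤ 2 ^ r * 3 ^ a
  unstored = *-cancelˡ-≤ (σ ^ A) {{m^n≢0 σ A}} (begin
    σ ^ A * σ ^ D            ≡⟨ ^-distribˡ-+-* σ A D ⟨
    σ ^ (A + D)              ≡⟨ cong (σ ^_) (m+[n∸m]≡n A≤n) ⟩
    σ ^ n                    ≤⟨ counting ⟩
    2 ^ r * (3 ^ a * σ ^ A)  ≡⟨ solve 3 (λ x y z → x :* (y :* z) := z :* (x :* y)) refl (2 ^ r) (3 ^ a) (σ ^ A) ⟩
    σ ^ A * (2 ^ r * 3 ^ a)  ∎)

stored≤n : ∀ t n A → suc t * A ≤ t * n → A ≤ n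
stored≤n t n A stored = *-cancelˡ-≤ (suc t) (≤-trans stored (*-monoˡ-≤ n (n≤1+n t)))

unstored-fraction : ∀ t n A → suc t * A ≤ t * n → n ≤ suc t * (n ∸ A)
unstored-fraction t n A stored = +-cancelʳ-≤ (t * n) n (suc t * D) (begin
  n + t * n                ≡⟨ cong (suc t *_) (m+[n∸m]≡n (stored≤n t n A stored)) ⟨
  suc t * (A + D)          ≡⟨ *-distribˡ-+ (suc t) A D ⟩
  suc t * A + suc t * D    ≤⟨ +-monoˡ-≤ (suc t * D) stored ⟩
  t * n + suc t * D        ≡⟨ +-comm (t * n) _ ⟩
  suc t * D + t * n        ∎)
  where
  open ≤-Reasoning
  D : ℕ
  D = n ∸ A

absorb-linear : ∀ n t r L → n * L ≤ suc t * (r + 5 * n) → 10 * suc t ≤ L → n * L ≤ 2 * (suc t * r)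
absorb-linear n t r L bound 10[t+1]≤L = +-cancelʳ-≤ (n * L) _ _ (begin
  n * L + n * L                           ≡⟨ solve 1 (λ x → x :+ x := con 2 :* x) refl (n * L) ⟩
  2 * (n * L)                             ≤⟨ *-monoʳ-≤ 2 bound ⟩
  2 * (suc t * (r + 5 * n))               ≡⟨ solve 3 (λ u r n → con 2 :* (u :* (r :+ con 5 :* n)) := con 2 :* (u :* r) :+ n :* (con 10 :* u)) refl (suc t) r n ⟩
  2 * (suc t * r) + n * (10 * suc t)      ≤⟨ +-monoʳ-≤ (2 * (suc t * r)) (*-monoʳ-≤ n 10[t+1]≤L) ⟩
  2 * (suc t * r) + n * L                 ∎)
  where open ≤-Reasoning

redundancy-bound : ∀ σ n t r L .{{_ : NonZero σ}} → σ ≤ n → 2 ^ L ≤ σ → 10 * suc t ≤ L →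
  σ ^ n ≤ 2 ^ r * (3 ^ (σ + n + n) * σ ^ (t * n / suc t)) → n * L ≤ 2 * (suc t * r)
redundancy-bound σ n t r L σ≤n 2^L≤σ 10[t+1]≤L counting = absorb-linear n t r L (begin
  n * L                     ≤⟨ *-monoˡ-≤ L (unstored-fraction t n A stored) ⟩
  suc t * (n ∸ A) * L       ≡⟨ solve 3 (λ u d L → u :* d :* L := u :* (L :* d)) refl (suc t) (n ∸ A) L ⟩
  suc t * (L * (n ∸ A))     ≤⟨ *-monoʳ-≤ (suc t) (exponent-bound σ n r (σ + n + n) A L (stored≤n t n A stored) 2^L≤σ σ+2n≤3n counting) ⟩
  suc t * (r + 5 * n)       ∎) 10[t+1]≤L
  where
  open ≤-Reasoning
  A : ℕ
  A = t * n / suc t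
  stored : suc t * A ≤ t * n
  stored = ≤-trans (≤-reflexive (*-comm (suc t) A)) (m/n*n≤m (t * n) (suc t))
  σ+2n≤3n : σ + n + n ≤ 3 * n
  σ+2n≤3n = ≤-trans (+-monoˡ-≤ n (+-monoˡ-≤ n σ≤n))
                    (≤-reflexive (solve 1 (λ n → n :+ n :+ n := con 3 :* n) refl n))

halve-threshold : ∀ t L → 20 ≤ L → 20 * t ≤ L → 10 * suc t ≤ L
halve-threshold t L 20≤L 20t≤L = *-cancelˡ-≤ 2 (begin
  2 * (10 * suc t)  ≡⟨ solve 1 (λ t → con 2 :* (con 10 :* (con 1 :+ t)) := con 20 :* t :+ con 20) refl t ⟩
  20 * t + 20       ≤⟨ +-mono-≤ 20t≤L 20≤L ⟩
  L + L             ≡⟨ solve 1 (λ L → L :+ L := con 2 :* L) refl L ⟩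
  2 * L             ∎)
  where open ≤-Reasoning

-- The lower bound for one alphabet size σ and length n, once log σ is at
-- least 20 and at least 20 t.  Matching on 1 ≤ σ exposes σ = suc _, which
-- provides NonZero σ and the padding symbol zero.
select-redundancy : ∀ {σ n t r} → SelectIndex σ n t r → 1 ≤ σ → σ ≤ n →
  20 ≤ ⌊log₂ σ ⌋ → 20 * t ≤ ⌊log₂ σ ⌋ → n * ⌊log₂ σ ⌋ ≤ 2 * (suc t * r)
select-redundancy {σ} {n} {t} {r} I 1≤σ@(s≤s z≤n) σ≤n 20≤L 20t≤L =
  redundancy-bound σ n t r ⌊log₂ σ ⌋ σ≤n (2^⌊log₂⌋≤ σ 1≤σ) (halve-threshold t _ 20≤L 20t≤L)
    (Encoding.counting-bound I zero)

-- Theorem: r = Ω(n log σ / t) with constant 2, for all σ ≥ M + 2^20, where M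
-- is the threshold from which 20·t ≤ log σ.
theorem3 : (t r : ℕ → ℕ → ℕ) →
    (∀ (σ n : ℕ) → 2 ≤ σ → σ ≤ n → SelectIndex σ n (t σ n) (r σ n)) →
    LittleOLogσ t →
    BigOmegaBound t r
theorem3 t r index-for t=o[logσ] = 2 , M + 2 ^ 20 , bound
  where
  M : ℕ
  M = proj₁ (t=o[logσ] 20)
  bound : ∀ σ n → M + 2 ^ 20 ≤ σ → σ ≤ n → n * ⌊log₂ σ ⌋ ≤ 2 * (suc (t σ n) * r σ n)
  bound σ n N≤σ σ≤n =
    select-redundancy (index-for σ n 2≤σ σ≤n) (≤-trans (s≤s z≤n) 2≤σ) σ≤n
      (≤⌊log₂⌋ 20 σ 2^20≤σ)
      (proj₂ (t=o[logσ] 20) σ n (≤-trans (m≤m+n M (2 ^ 20)) N≤σ) σ≤n)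
    where
    2^20≤σ : 2 ^ 20 ≤ σ
    2^20≤σ = ≤-trans (m≤n+m (2 ^ 20) M) N≤σ
    2≤σ : 2 ≤ σ
    2≤σ = ≤-trans (*-monoʳ-≤ 2 (m^n>0 2 19)) 2^20≤σ
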